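{- Let $A=(a_{ir})$ be a $k\times\ell$ matrix with non-negative rational entries whose underlying relation is rectangular. Then $A$ is a rank-one block matrix if, and only if, $a_{ir}^2a_{js}^2a_{is}a_{jr}=a_{is}^2a_{jr}^2a_{ir}a_{js}$ for all $i,j\in[k]$ and all $r,s\in[\ell]$.
   Context: The underlying relation of $A$ is $B=\{(i,r):a_{ir}>0\}\subseteq[k]\times[\ell]$; it is rectangular if $(i,r),(i,s),(j,r)\in B$ implies $(j,s)\in B$. $A$ is a rank-one block matrix if $B$ is rectangular and each block of $A$ — the submatrix induced on the rows and columns of a connected component of the bipartite graph with vertex classes $[k]$, $[\ell]$ and edge set $B$ — has rank one. -}

module Defs where

open import Data.Nat using (ℕ)
open import Data.Fin using (Fin)
open import Data.Sum using (_⊎_; inj₁; inj₂)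
open import Data.Product using (_×_; Σ; ∃; ∃-syntax)
open import Data.Rational using (ℚ; 0ℚ; _*_; _<_; _≤_)
open import Relation.Binary.PropositionalEquality using (_≡_; _≢_)
open import Relation.Binary.Construct.Closure.ReflexiveTransitive using (Star)

Matrix : ℕ → ℕ → Set
Matrix k ℓ = Fin k → Fin ℓ → ℚ

NonNegative : ∀ {k ℓ} → Matrix k ℓ → Set
NonNegative {k} {ℓ} A = (i : Fin k) (r : Fin ℓ) → 0ℚ ≤ A i r

InB : ∀ {k ℓ} → Matrix k ℓ → Fin k → Fin ℓ → Set
InB A i r = 0ℚ < A i r

Rectangular : ∀ {k ℓ} → Matrix k ℓ → Set
Rectangular {k} {ℓ} A = (i j : Fin k) (r s : Fin ℓ) →
  InB A i r → InB A i s → InB A j r → InB A j s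

Vertex : ℕ → ℕ → Set
Vertex k ℓ = Fin k ⊎ Fin ℓ

data Adj {k ℓ} (A : Matrix k ℓ) : Vertex k ℓ → Vertex k ℓ → Set where
  row→col : ∀ {i r} → InB A i r → Adj A (inj₁ i) (inj₂ r)
  col→row : ∀ {i r} → InB A i r → Adj A (inj₂ r) (inj₁ i)

Connected : ∀ {k ℓ} → Matrix k ℓ → Vertex k ℓ → Vertex k ℓ → Set
Connected A = Star (Adj A)

-- the submatrix of A on rows/columns of the component containing vertex v has rank one:
-- it is nonzero and an outer product u vᵀ
BlockRankOne : ∀ {k ℓ} → Matrix k ℓ → Vertex k ℓ → Set
BlockRankOne {k} {ℓ} A v =
  (∃[ j ] ∃[ s ] (Connected A v (inj₁ j) × Connected A v (inj₂ s) × A j s ≢ 0ℚ))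
  × (Σ (Fin k → ℚ) λ u → Σ (Fin ℓ → ℚ) λ w →
       (j : Fin k) (s : Fin ℓ) → Connected A v (inj₁ j) → Connected A v (inj₂ s) →
       A j s ≡ u j * w s)

-- rank-one block matrix: B rectangular and every block (component carrying an edge) has rank one
RankOneBlockMatrix : ∀ {k ℓ} → Matrix k ℓ → Set
RankOneBlockMatrix {k} {ℓ} A =
  Rectangular A × ((i : Fin k) (r : Fin ℓ) → InB A i r → BlockRankOne A (inj₁ i))

{-# OPTIONS --safe #-}
-- The identity a² b² c d = c² d² a b says that ab·cd·(ab − cd) = 0, so for an
-- entry quadruple a = A i r, b = A j s, c = A i s, d = A j r it holds exactly when
-- one entry vanishes or ab = cd. A rank-one block u wᵀ has ab = cd. Conversely,
-- fix (i,r) ∈ B: by rectangularity every row j and column s of its component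
-- satisfy (j,r), (i,s) ∈ B, hence (j,s) ∈ B, and cancelling the positive entries
-- gives A j s = (A j r / A i r) · A i s, an outer product.
module Submission where

open import Defs
open import Data.Nat using (ℕ)
open import Data.Fin using (Fin)
open import Data.Rational using (ℚ; _*_; 0ℚ; 1ℚ; 1/_; _<_; _≤_; NonZero; ≢-nonZero)
open import Data.Rational.Properties
  using (_<?_; ≮⇒≥; ≤-antisym; <⇒≢; *-identityʳ; *-inverseʳ)
open import Data.Rational.Solver using (module +-*-Solver)
open import Data.Sum using (_⊎_; inj₁; inj₂)
open import Data.Product using (_,_)
open import Function.Bundles using (_⇔_; mk⇔)
open import Relation.Nullary using (yes; no)
open import Relation.Binary.PropositionalEquality
  using (_≡_; refl; sym; cong; cong₂; ≢-sym; module ≡-Reasoning)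
open import Relation.Binary.Construct.Closure.ReflexiveTransitive using (ε; _◅_)
open +-*-Solver

positive-or-zero : ∀ {x} → 0ℚ ≤ x → 0ℚ < x ⊎ x ≡ 0ℚ
positive-or-zero {x} 0≤x with 0ℚ <? x
... | yes 0<x = inj₁ 0<x
... | no  0≮x = inj₂ (≤-antisym (≮⇒≥ 0≮x) 0≤x)

>0⇒nonZero : ∀ {x} → 0ℚ < x → NonZero x
>0⇒nonZero 0<x = ≢-nonZero (≢-sym (<⇒≢ 0<x))

*-cancelʳ-≡ : ∀ {x y} c .{{_ : NonZero c}} → x * c ≡ y * c → x ≡ y
*-cancelʳ-≡ {x} {y} c xc≡yc = begin
  x                ≡⟨ inverse-cancels x ⟨
  x * c * (1/ c)   ≡⟨ cong (_* (1/ c)) xc≡yc ⟩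
  y * c * (1/ c)   ≡⟨ inverse-cancels y ⟩
  y                ∎
  where
  open ≡-Reasoning
  inverse-cancels : ∀ z → z * c * (1/ c) ≡ z
  inverse-cancels z = begin
    z * c * (1/ c)   ≡⟨ solve 3 (λ z c c⁻¹ → z :* c :* c⁻¹ := z :* (c :* c⁻¹)) refl z c (1/ c) ⟩
    z * (c * 1/ c)   ≡⟨ cong (z *_) (*-inverseʳ c) ⟩
    z * 1ℚ           ≡⟨ *-identityʳ z ⟩
    z                ∎

CrossIdentity : ℚ → ℚ → ℚ → ℚ → Set
CrossIdentity a b c d = a * a * (b * b) * c * d ≡ c * c * (d * d) * a * b

*≡*⇒crossIdentity : ∀ a b c d → a * b ≡ c * d → CrossIdentity a b c d
*≡*⇒crossIdentity a b c d ab≡cd = begin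
  a * a * (b * b) * c * d   ≡⟨ solve 4 (λ a b c d → a :* a :* (b :* b) :* c :* d
                                       := a :* b :* (a :* b) :* (c :* d)) refl a b c d ⟩
  a * b * (a * b) * (c * d) ≡⟨ cong (λ x → x * x * (c * d)) ab≡cd ⟩
  c * d * (c * d) * (c * d) ≡⟨ cong (λ x → c * d * (c * d) * x) (sym ab≡cd) ⟩
  c * d * (c * d) * (a * b) ≡⟨ solve 4 (λ a b c d → c :* d :* (c :* d) :* (a :* b)
                                       := c :* c :* (d :* d) :* a :* b) refl a b c d ⟩
  c * c * (d * d) * a * b   ∎
  where open ≡-Reasoning

nonNeg⇒crossIdentity : ∀ {a b c d} → 0ℚ ≤ a → 0ℚ ≤ b → 0ℚ ≤ c → 0ℚ ≤ d →
  (0ℚ < a → 0ℚ < b → 0ℚ < c → 0ℚ < d → a * b ≡ c * d) → CrossIdentity a b c d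
nonNeg⇒crossIdentity {a} {b} {c} {d} 0≤a 0≤b 0≤c 0≤d positive⇒*≡*
  with positive-or-zero 0≤a | positive-or-zero 0≤b | positive-or-zero 0≤c | positive-or-zero 0≤d
... | inj₂ refl | _ | _ | _ =
  solve 3 (λ b c d → con 0ℚ :* con 0ℚ :* (b :* b) :* c :* d
                   := c :* c :* (d :* d) :* con 0ℚ :* b) refl b c d
... | _ | inj₂ refl | _ | _ =
  solve 3 (λ a c d → a :* a :* (con 0ℚ :* con 0ℚ) :* c :* d
                   := c :* c :* (d :* d) :* a :* con 0ℚ) refl a c d
... | _ | _ | inj₂ refl | _ =
  solve 3 (λ a b d → a :* a :* (b :* b) :* con 0ℚ :* d
                   := con 0ℚ :* con 0ℚ :* (d :* d) :* a :* b) refl a b d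
... | _ | _ | _ | inj₂ refl =
  solve 3 (λ a b c → a :* a :* (b :* b) :* c :* con 0ℚ
                   := c :* c :* (con 0ℚ :* con 0ℚ) :* a :* b) refl a b c
... | inj₁ 0<a | inj₁ 0<b | inj₁ 0<c | inj₁ 0<d =
  *≡*⇒crossIdentity a b c d (positive⇒*≡* 0<a 0<b 0<c 0<d)

crossIdentity⇒*≡* : ∀ a b c d → .{{_ : NonZero a}} → .{{_ : NonZero b}} →
  .{{_ : NonZero c}} → .{{_ : NonZero d}} → CrossIdentity a b c d → a * b ≡ c * d
crossIdentity⇒*≡* a b c d cross =
  *-cancelʳ-≡ a (*-cancelʳ-≡ b (*-cancelʳ-≡ c (*-cancelʳ-≡ d (begin
    a * b * a * b * c * d     ≡⟨ solve 4 (λ a b c d → a :* b :* a :* b :* c :* d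
                                         := a :* a :* (b :* b) :* c :* d) refl a b c d ⟩
    a * a * (b * b) * c * d   ≡⟨ cross ⟩
    c * c * (d * d) * a * b   ≡⟨ solve 4 (λ a b c d → c :* c :* (d :* d) :* a :* b
                                         := c :* d :* a :* b :* c :* d) refl a b c d ⟩
    c * d * a * b * c * d     ∎))))
  where open ≡-Reasoning

*≡*⇒quotient : ∀ a b c d → .{{_ : NonZero a}} → a * b ≡ c * d → b ≡ d * (1/ a) * c
*≡*⇒quotient a b c d ab≡cd = begin
  b                   ≡⟨ *-identityʳ b ⟨
  b * 1ℚ              ≡⟨ cong (b *_) (*-inverseʳ a) ⟨
  b * (a * 1/ a)      ≡⟨ solve 3 (λ a b a⁻¹ → b :* (a :* a⁻¹) := a :* b :* a⁻¹) refl a b (1/ a) ⟩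
  a * b * (1/ a)      ≡⟨ cong (_* (1/ a)) ab≡cd ⟩
  c * d * (1/ a)      ≡⟨ solve 3 (λ c d a⁻¹ → c :* d :* a⁻¹ := d :* a⁻¹ :* c) refl c d (1/ a) ⟩
  d * (1/ a) * c      ∎
  where open ≡-Reasoning

outerProduct-cross : ∀ ui uj wr ws → ui * wr * (uj * ws) ≡ ui * ws * (uj * wr)
outerProduct-cross = solve 4 (λ ui uj wr ws → ui :* wr :* (uj :* ws) := ui :* ws :* (uj :* wr)) refl

module _ {k ℓ : ℕ} (A : Matrix k ℓ) (rect : Rectangular A) {i : Fin k} {r : Fin ℓ}
         (ir∈B : InB A i r) where

  Attached : Vertex k ℓ → Set
  Attached (inj₁ j) = InB A j r
  Attached (inj₂ s) = InB A i s

  adj-preserves-attached : ∀ {x y} → Attached x → Adj A x y → Attached y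
  adj-preserves-attached jr∈B (row→col {j} {s} js∈B) = rect j i r s jr∈B js∈B ir∈B
  adj-preserves-attached is∈B (col→row {j} {s} js∈B) = rect i j s r is∈B ir∈B js∈B

  connected⇒attached : ∀ {y} → Connected A (inj₁ i) y → Attached y
  connected⇒attached = go ir∈B
    where
    go : ∀ {x y} → Attached x → Connected A x y → Attached y
    go att ε          = att
    go att (xz ◅ zy)  = go (adj-preserves-attached att xz) zy

module _ {k ℓ : ℕ} (A : Matrix k ℓ) where

  CrossCondition : Set
  CrossCondition = (i j : Fin k) (r s : Fin ℓ) →
    CrossIdentity (A i r) (A j s) (A i s) (A j r)

  rankOneBlockMatrix⇒crossCondition : NonNegative A → RankOneBlockMatrix A → CrossCondition
  rankOneBlockMatrix⇒crossCondition nonNeg (_ , rankOne) i j r s =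
    nonNeg⇒crossIdentity (nonNeg i r) (nonNeg j s) (nonNeg i s) (nonNeg j r) cross
    where
    cross : InB A i r → InB A j s → InB A i s → InB A j r → A i r * A j s ≡ A i s * A j r
    cross ir∈B _ is∈B jr∈B with rankOne i r ir∈B
    ... | _ , u , w , u⊗w = begin
      A i r * A j s             ≡⟨ cong₂ _*_ (u⊗w i r i~i i~r) (u⊗w j s i~j i~s) ⟩
      u i * w r * (u j * w s)   ≡⟨ outerProduct-cross (u i) (u j) (w r) (w s) ⟩
      u i * w s * (u j * w r)   ≡⟨ cong₂ _*_ (u⊗w i s i~i i~s) (u⊗w j r i~j i~r) ⟨
      A i s * A j r             ∎
      where
      open ≡-Reasoning
      i~i : Connected A (inj₁ i) (inj₁ i)
      i~i = ε
      i~r : Connected A (inj₁ i) (inj₂ r)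
      i~r = row→col ir∈B ◅ ε
      i~s : Connected A (inj₁ i) (inj₂ s)
      i~s = row→col is∈B ◅ ε
      i~j : Connected A (inj₁ i) (inj₁ j)
      i~j = row→col ir∈B ◅ col→row jr∈B ◅ ε

  crossCondition⇒rankOneBlockMatrix : Rectangular A → CrossCondition → RankOneBlockMatrix A
  crossCondition⇒rankOneBlockMatrix rect cross = rect , rankOne
    where
    rankOne : (i : Fin k) (r : Fin ℓ) → InB A i r → BlockRankOne A (inj₁ i)
    rankOne i r ir∈B =
      (i , r , ε , row→col ir∈B ◅ ε , ≢-sym (<⇒≢ ir∈B)) ,
      (λ j → A j r * (1/ A i r)) , (λ s → A i s) , outer
      where
      instance
        A-ir≢0 : NonZero (A i r)
        A-ir≢0 = >0⇒nonZero ir∈B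
      outer : (j : Fin k) (s : Fin ℓ) → Connected A (inj₁ i) (inj₁ j) →
              Connected A (inj₁ i) (inj₂ s) → A j s ≡ A j r * (1/ A i r) * A i s
      outer j s i~j i~s =
        *≡*⇒quotient (A i r) (A j s) (A i s) (A j r)
          (crossIdentity⇒*≡* (A i r) (A j s) (A i s) (A j r) (cross i j r s))
        where
        jr∈B : InB A j r
        jr∈B = connected⇒attached A rect ir∈B i~j
        is∈B : InB A i s
        is∈B = connected⇒attached A rect ir∈B i~s
        instance
          A-js≢0 : NonZero (A j s)
          A-js≢0 = >0⇒nonZero (rect i j r s ir∈B is∈B jr∈B)
          A-is≢0 : NonZero (A i s)
          A-is≢0 = >0⇒nonZero is∈B
          A-jr≢0 : NonZero (A j r)
          A-jr≢0 = >0⇒nonZero jr∈B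

corollary8p4 : (k ℓ : ℕ) (A : Matrix k ℓ) → NonNegative A → Rectangular A →
    (RankOneBlockMatrix A ⇔
      ((i j : Fin k) (r s : Fin ℓ) →
        A i r * A i r * (A j s * A j s) * A i s * A j r
          ≡ A i s * A i s * (A j r * A j r) * A i r * A j s))
corollary8p4 k ℓ A nonNeg rect =
  mk⇔ (rankOneBlockMatrix⇒crossCondition A nonNeg)
      (crossCondition⇒rankOneBlockMatrix A rect)
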